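{- Let $A$ be a finite local ring, $a\in A\setminus U(A)$ and $n\ge2$. Then $|R_n^{a}(A)|=|R_n^{0_A}(A)|$, where $R_n^{b}(A)=\{(a_1,\dots,a_n)\in A^n : K_n(a_1,\dots,a_n)=b\}$.
   Context: $U(A)$ is the unit group of $A$. A local ring is a commutative unitary ring with a unique maximal ideal. The continuants are defined by $K_{ -1}:=0_A$, $K_0:=1_A$, and for $i\ge1$, $K_i(X_1,\dots,X_i)$ is the determinant of the $i\times i$ tridiagonal matrix with diagonal $X_1,\dots,X_i$ and all entries on the sub- and super-diagonal equal to $1_A$. -}

module Defs where

open import Level using (0ℓ)
open import Algebra.Bundles using (CommutativeRing)
open import Data.Nat using (ℕ; zero; suc)
open import Data.Fin using (Fin)
open import Relation.Binary.PropositionalEquality using (_≡_)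
open import Data.Vec using (Vec; []; _∷_; toList; map)
open import Data.List as List using (List; []; _∷_; length; filter; reverse; concatMap; allFin)
open import Data.Product using (Σ; ∃; _×_; _,_)
open import Relation.Nullary using (¬_; Dec)
open import Relation.Binary using (Decidable)

module _ (A : CommutativeRing 0ℓ 0ℓ) where
  open CommutativeRing A

  IsUnit : Carrier → Set
  IsUnit a = ∃ λ b → a * b ≈ 1#

  record Ideal : Set₁ where
    field
      P      : Carrier → Set
      resp   : ∀ {x y} → x ≈ y → P x → P y
      zero∈  : P 0#
      +-cl   : ∀ {x y} → P x → P y → P (x + y)
      *-cl   : ∀ r {x} → P x → P (r * x)
  open Ideal public

  _⊆I_ : Ideal → Ideal → Set
  I ⊆I J = ∀ x → P I x → P J x

  IsMaximal : Ideal → Set₁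
  IsMaximal M = (¬ P M 1#) × (∀ (J : Ideal) → M ⊆I J → ¬ P J 1# → J ⊆I M)

  IsLocal : Set₁
  IsLocal = Σ Ideal λ M → IsMaximal M × (∀ N → IsMaximal N → (N ⊆I M) × (M ⊆I N))

  record FiniteEnum : Set where
    field
      size   : ℕ
      enum   : Fin size → Carrier
      inj    : ∀ i j → enum i ≈ enum j → i ≡ j
      surj   : ∀ x → ∃ λ i → enum i ≈ x

  -- K_i(X_1..X_i) = det of the tridiagonal matrix (diag X, off-diagonals 1);
  -- expanding along the last row: K_i = X_i K_{i-1} - K_{i-2}, K_0 = 1, K_{-1} = 0.
  -- Krev takes the arguments in reversed order (last argument first).
  Krev : List Carrier → Carrier
  Krev []            = 1#
  Krev (x ∷ [])      = x
  Krev (x ∷ y ∷ xs)  = x * Krev (y ∷ xs) - Krev xs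

  K : ∀ n → Vec Carrier n → Carrier
  K n v = Krev (reverse (toList v))

allVecs : ∀ m n → List (Vec (Fin m) n)
allVecs m zero    = [] ∷ []
allVecs m (suc n) = concatMap (λ i → List.map (i ∷_) (allVecs m n)) (allFin m)

module _ (A : CommutativeRing 0ℓ 0ℓ) where
  open CommutativeRing A

  countR : (_≟_ : Decidable _≈_) (F : FiniteEnum A) (n : ℕ) (b : Carrier) → ℕ
  countR _≟_ F n b =
    length (filter (λ v → K A n (map (FiniteEnum.enum F) v) ≟ b) (allVecs (FiniteEnum.size F) n))

-- Expanding the continuant along its last entry, K_n(a_1, …, a_n) = a_n p − q with
-- p = K_{n−1}(a_1, …, a_{n−1}) and q = K_{n−2}(a_1, …, a_{n−2}), so |R_n^b| is a sum, over the
-- first n − 1 entries, of the number of roots of x ↦ x p − q = b.  Consecutive continuants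
-- generate the unit ideal, so p and q are not both in the maximal ideal M.  If p is a unit the
-- equation has exactly one root for every b; otherwise p ∈ M, q ∉ M and there is no root for
-- any b ∈ M.  Both a and 0 lie in M, hence every summand agrees.  That a nonunit lies in M uses
-- finiteness: the ideal it generates is enlarged to a maximal ideal by greedily adjoining
-- elements that keep it proper.

module Submission where

open import Level using (0ℓ)
open import Algebra.Bundles using (CommutativeRing)
open import Data.Bool using (true; false)
open import Data.Empty using (⊥-elim)
open import Data.Fin as Fin using (Fin)
open import Data.Fin.Properties using (any?; suc-injective; 0≢1+n)
open import Data.List
  using (List; []; _∷_; [_]; _++_; map; concatMap; filter; length; tabulate; allFin; reverse)
open import Data.List.Properties
  using (filter-++; length-++; filter-accept; filter-reject; filter-none; filter-≐;
         map-cong; map-∘; concatMap-cong; concatMap-map; map-concatMap; concatMap-pure;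
         ++-identityʳ; reverse-++)
open import Data.List.Effectful using (module MonadProperties)
open import Data.List.Membership.Propositional using (_∈_)
open import Data.List.Membership.Propositional.Properties using (∈-allFin)
open import Data.List.Relation.Unary.Any using (here; there)
open import Data.List.Relation.Unary.All.Properties using (tabulate⁺)
open import Data.Nat as ℕ using (ℕ; zero; suc; _≥_)
open import Data.Nat.ListAction using (sum)
open import Data.Product using (Σ-syntax; ∃; _×_; _,_; proj₁; proj₂)
open import Data.Vec as Vec using (Vec; []; _∷_; _∷ʳ_; toList)
open import Data.Vec.Properties using (map-∷ʳ; toList-∷ʳ)
open import Function using (_∘_)
open import Relation.Binary using (Decidable)
open import Relation.Binary.PropositionalEquality as ≡ using (_≡_; module ≡-Reasoning)
open import Relation.Nullary using (¬_; Dec; yes; no; does)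
open import Relation.Nullary.Decidable using (map′)
open import Relation.Unary using (Pred; _≐_)
import Relation.Unary as U
import Relation.Binary.Reasoning.Setoid as SetoidReasoning

open import Defs

reverse-toList-∷ʳ : ∀ {X : Set} {n} (xs : Vec X n) x →
  reverse (toList (xs ∷ʳ x)) ≡ x ∷ reverse (toList xs)
reverse-toList-∷ʳ xs x = begin
  reverse (toList (xs ∷ʳ x))     ≡⟨ ≡.cong reverse (toList-∷ʳ x xs) ⟩
  reverse (toList xs ++ [ x ])   ≡⟨ reverse-++ (toList xs) [ x ] ⟩
  x ∷ reverse (toList xs)        ∎
  where open ≡-Reasoning

allVecs-∷ʳ : ∀ m n → allVecs m (suc n) ≡ concatMap (λ v → map (v ∷ʳ_) (allFin m)) (allVecs m n)
allVecs-∷ʳ m zero = begin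
  concatMap ([_] ∘ (_∷ [])) (allFin m)   ≡⟨ concatMap-map [_] (_∷ []) (allFin m) ⟨
  concatMap [_] (map (_∷ []) (allFin m)) ≡⟨ concatMap-pure _ ⟩
  map (_∷ []) (allFin m)                 ≡⟨ ++-identityʳ _ ⟨
  map (_∷ []) (allFin m) ++ []           ∎
  where open ≡-Reasoning
allVecs-∷ʳ m (suc n) = begin
  concatMap (λ i → map (i ∷_) (allVecs m (suc n))) Fs
    ≡⟨ concatMap-cong (λ i → ≡.cong (map (i ∷_)) (allVecs-∷ʳ m n)) Fs ⟩
  concatMap (λ i → map (i ∷_) (concatMap (λ w → map (w ∷ʳ_) Fs) (allVecs m n))) Fs
    ≡⟨ concatMap-cong (λ i → map-concatMap (i ∷_) _ (allVecs m n)) Fs ⟩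
  concatMap (λ i → concatMap (λ w → map (i ∷_) (map (w ∷ʳ_) Fs)) (allVecs m n)) Fs
    ≡⟨ concatMap-cong (λ i → concatMap-cong (λ w → map-∘ Fs) (allVecs m n)) Fs ⟨
  concatMap (λ i → concatMap (λ w → map ((i ∷ w) ∷ʳ_) Fs) (allVecs m n)) Fs
    ≡⟨ concatMap-cong (λ i → concatMap-map _ (i ∷_) (allVecs m n)) Fs ⟨
  concatMap (λ i → concatMap (λ v → map (v ∷ʳ_) Fs) (map (i ∷_) (allVecs m n))) Fs
    ≡⟨ MonadProperties.associative Fs (λ i → map (i ∷_) (allVecs m n)) (λ v → map (v ∷ʳ_) Fs) ⟩
  concatMap (λ v → map (v ∷ʳ_) Fs) (concatMap (λ i → map (i ∷_) (allVecs m n)) Fs) ∎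
  where
  open ≡-Reasoning
  Fs : List (Fin m)
  Fs = allFin m

module _ {X Y : Set} {P : Pred Y 0ℓ} (P? : U.Decidable P) where

  length-filter-concatMap : ∀ (f : X → List Y) xs →
    length (filter P? (concatMap f xs)) ≡ sum (map (λ x → length (filter P? (f x))) xs)
  length-filter-concatMap f []       = ≡.refl
  length-filter-concatMap f (x ∷ xs) = begin
    length (filter P? (f x ++ concatMap f xs))
      ≡⟨ ≡.cong length (filter-++ P? (f x) (concatMap f xs)) ⟩
    length (filter P? (f x) ++ filter P? (concatMap f xs))
      ≡⟨ length-++ (filter P? (f x)) ⟩
    length (filter P? (f x)) ℕ.+ length (filter P? (concatMap f xs))
      ≡⟨ ≡.cong (length (filter P? (f x)) ℕ.+_) (length-filter-concatMap f xs) ⟩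
    length (filter P? (f x)) ℕ.+ sum (map (λ x → length (filter P? (f x))) xs) ∎
    where open ≡-Reasoning

  length-filter-map : ∀ (f : X → Y) xs → length (filter P? (map f xs)) ≡ length (filter (P? ∘ f) xs)
  length-filter-map f []       = ≡.refl
  length-filter-map f (x ∷ xs) with does (P? (f x))
  ... | true  = ≡.cong suc (length-filter-map f xs)
  ... | false = length-filter-map f xs

module _ {X : Set} {P : Pred X 0ℓ} (P? : U.Decidable P) where

  length-filter-tabulate-none : ∀ {n} (f : Fin n → X) → (∀ i → ¬ P (f i)) →
    length (filter P? (tabulate f)) ≡ 0
  length-filter-tabulate-none f none = ≡.cong length (filter-none P? (tabulate⁺ none))

  length-filter-tabulate-unique : ∀ {n} (f : Fin n → X) i → P (f i) → (∀ j → P (f j) → j ≡ i) →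
    length (filter P? (tabulate f)) ≡ 1
  length-filter-tabulate-unique f Fin.zero Pfi unique
    rewrite filter-accept P? {xs = tabulate (f ∘ Fin.suc)} Pfi =
    ≡.cong suc (length-filter-tabulate-none (f ∘ Fin.suc)
                  (λ j Pfj → 0≢1+n (≡.sym (unique (Fin.suc j) Pfj))))
  length-filter-tabulate-unique f (Fin.suc i) Pfi unique
    rewrite filter-reject P? {xs = tabulate (f ∘ Fin.suc)} (λ Pf0 → 0≢1+n (unique Fin.zero Pf0)) =
    length-filter-tabulate-unique (f ∘ Fin.suc) i Pfi (λ j Pfj → suc-injective (unique (Fin.suc j) Pfj))

module Ideals (A : CommutativeRing 0ℓ 0ℓ) where
  open CommutativeRing A
  open import Algebra.Properties.AbelianGroup +-abelianGroup using (⁻¹-anti-homo‿-; xyx⁻¹≈y)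
  open import Algebra.Properties.CommutativeSemigroup +-commutativeSemigroup using (interchange)
  open import Algebra.Properties.Group +-group using (//-rightDividesˡ; x∙y⁻¹≈ε⇒x≈y)
  open import Algebra.Properties.Ring ring using (-1*x≈-x; -0#≈0#; -‿+-comm; x[y-z]≈xy-xz)
  open import Relation.Binary.Reasoning.Setoid setoid

  x-[x-y]≈y : ∀ x y → x - (x - y) ≈ y
  x-[x-y]≈y x y = begin
    x - (x - y)  ≈⟨ +-cong refl (⁻¹-anti-homo‿- x y) ⟩
    x + (y - x)  ≈⟨ +-assoc x y (- x) ⟨
    x + y - x    ≈⟨ xyx⁻¹≈y x y ⟩
    y            ∎

  x-0y≈x : ∀ x y → x - 0# * y ≈ x
  x-0y≈x x y = begin
    x - 0# * y   ≈⟨ +-cong refl (-‿cong (zeroˡ y)) ⟩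
    x - 0#       ≈⟨ +-cong refl -0#≈0# ⟩
    x + 0#       ≈⟨ +-identityʳ x ⟩
    x            ∎

  -‿closed : (I : Ideal A) → ∀ {x y} → P I x → P I y → P I (x - y)
  -‿closed I {y = y} x∈I y∈I = +-cl I x∈I (resp I (-1*x≈-x y) (*-cl I (- 1#) y∈I))

  _⊆_ : Ideal A → Ideal A → Set
  _⊆_ = _⊆I_ A

  infix 4 _∈⟨_⟩

  -- Membership in the ideal generated by a list, peeling off one generator at a time.
  _∈⟨_⟩ : Carrier → List Carrier → Set
  x ∈⟨ [] ⟩     = x ≈ 0#
  x ∈⟨ g ∷ gs ⟩ = ∃ λ r → x - r * g ∈⟨ gs ⟩

  ∈⟨⟩-resp : ∀ gs {x y} → x ≈ y → x ∈⟨ gs ⟩ → y ∈⟨ gs ⟩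
  ∈⟨⟩-resp []       x≈y x≈0      = trans (sym x≈y) x≈0
  ∈⟨⟩-resp (g ∷ gs) x≈y (r , x∈) = r , ∈⟨⟩-resp gs (+-cong x≈y refl) x∈

  ∈⟨∷⟩ʳ : ∀ g gs {x} → x ∈⟨ gs ⟩ → x ∈⟨ g ∷ gs ⟩
  ∈⟨∷⟩ʳ g gs {x} x∈ = 0# , ∈⟨⟩-resp gs (sym (x-0y≈x x g)) x∈

  0∈⟨⟩ : ∀ gs → 0# ∈⟨ gs ⟩
  0∈⟨⟩ []       = refl
  0∈⟨⟩ (g ∷ gs) = ∈⟨∷⟩ʳ g gs (0∈⟨⟩ gs)

  ∈⟨∷⟩ˡ : ∀ g gs → g ∈⟨ g ∷ gs ⟩
  ∈⟨∷⟩ˡ g gs = 1# , ∈⟨⟩-resp gs 0≈g-1g (0∈⟨⟩ gs)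
    where
    0≈g-1g : 0# ≈ g - 1# * g
    0≈g-1g = sym (trans (+-cong refl (-‿cong (*-identityˡ g))) (-‿inverseʳ g))

  +-∈⟨⟩ : ∀ gs {x y} → x ∈⟨ gs ⟩ → y ∈⟨ gs ⟩ → x + y ∈⟨ gs ⟩
  +-∈⟨⟩ []       x≈0 y≈0 = trans (+-cong x≈0 y≈0) (+-identityʳ 0#)
  +-∈⟨⟩ (g ∷ gs) {x} {y} (r , x∈) (s , y∈) = r + s , ∈⟨⟩-resp gs regroup (+-∈⟨⟩ gs x∈ y∈)
    where
    regroup : (x - r * g) + (y - s * g) ≈ (x + y) - (r + s) * g
    regroup = begin
      (x - r * g) + (y - s * g)       ≈⟨ interchange x (- (r * g)) y (- (s * g)) ⟩
      (x + y) + (- (r * g) - s * g)   ≈⟨ +-cong refl (-‿+-comm (r * g) (s * g)) ⟩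
      (x + y) - (r * g + s * g)       ≈⟨ +-cong refl (-‿cong (distribʳ g r s)) ⟨
      (x + y) - (r + s) * g           ∎

  *-∈⟨⟩ : ∀ gs t {x} → x ∈⟨ gs ⟩ → t * x ∈⟨ gs ⟩
  *-∈⟨⟩ []       t x≈0          = trans (*-cong refl x≈0) (zeroʳ t)
  *-∈⟨⟩ (g ∷ gs) t {x} (r , x∈) = t * r , ∈⟨⟩-resp gs distribute (*-∈⟨⟩ gs t x∈)
    where
    distribute : t * (x - r * g) ≈ t * x - (t * r) * g
    distribute = trans (x[y-z]≈xy-xz t x (r * g)) (+-cong refl (-‿cong (sym (*-assoc t r g))))

  ⟨_⟩ : List Carrier → Ideal A
  ⟨ gs ⟩ = record
    { P = _∈⟨ gs ⟩ ; resp = ∈⟨⟩-resp gs ; zero∈ = 0∈⟨⟩ gs ; +-cl = +-∈⟨⟩ gs ; *-cl = *-∈⟨⟩ gs }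

  ⟨∷⟩⊆ : (J : Ideal A) → ∀ {g gs} → P J g → ⟨ gs ⟩ ⊆ J → ⟨ g ∷ gs ⟩ ⊆ J
  ⟨∷⟩⊆ J g∈J gs⊆J x (r , x-rg∈) = resp J (//-rightDividesˡ _ x) (+-cl J (gs⊆J _ x-rg∈) (*-cl J r g∈J))

  1∈⟨x⟩⇒unit : ∀ {x} → 1# ∈⟨ x ∷ [] ⟩ → IsUnit A x
  1∈⟨x⟩⇒unit {x} (r , 1-rx≈0) = r , trans (*-comm x r) (sym (x∙y⁻¹≈ε⇒x≈y 1# (r * x) 1-rx≈0))

module Continuants (A : CommutativeRing 0ℓ 0ℓ) where
  open CommutativeRing A
  open Ideals A using (x-[x-y]≈y; -‿closed)
  open import Algebra.Properties.Ring ring using (-0#≈0#)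
  open import Relation.Binary.Reasoning.Setoid setoid

  Kprev : List Carrier → Carrier
  Kprev []       = 0#
  Kprev (_ ∷ xs) = Krev A xs

  Krev-∷ : ∀ x xs → Krev A (x ∷ xs) ≈ x * Krev A xs - Kprev xs
  Krev-∷ x []      = begin
    x             ≈⟨ +-identityʳ x ⟨
    x + 0#        ≈⟨ +-cong (*-identityʳ x) -0#≈0# ⟨
    x * 1# - 0#   ∎
  Krev-∷ x (_ ∷ _) = refl

  continuants-comaximal : (I : Ideal A) → ¬ P I 1# → ∀ xs → ¬ (P I (Krev A xs) × P I (Kprev xs))
  continuants-comaximal I 1∉I []       (1∈I , _)         = 1∉I 1∈I
  continuants-comaximal I 1∉I (x ∷ xs) (Kx∷xs∈I , Kxs∈I) =
    continuants-comaximal I 1∉I xs (Kxs∈I , resp I Kprev-eq (-‿closed I (*-cl I x Kxs∈I) Kx∷xs∈I))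
    where
    Kprev-eq : x * Krev A xs - Krev A (x ∷ xs) ≈ Kprev xs
    Kprev-eq = trans (+-cong refl (-‿cong (Krev-∷ x xs))) (x-[x-y]≈y _ _)

module FiniteRing
  (A : CommutativeRing 0ℓ 0ℓ) (_≟_ : Decidable (CommutativeRing._≈_ A)) (F : FiniteEnum A) where
  open CommutativeRing A
  open FiniteEnum F
  open Ideals A
  open Continuants A
  open import Algebra.Properties.Group +-group using (//-rightDividesˡ; //-rightDividesʳ)
  open import Algebra.Properties.CommutativeSemigroup *-commutativeSemigroup using (xy∙z≈x∙zy)
  module ≈-Reasoning = SetoidReasoning setoid

  ∃? : ∀ {Q : Carrier → Set} → (∀ {x y} → x ≈ y → Q x → Q y) → U.Decidable Q → Dec (∃ Q)
  ∃? Q-resp Q? = map′ (λ (i , Qi) → enum i , Qi)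
    (λ (x , Qx) → proj₁ (surj x) , Q-resp (sym (proj₂ (surj x))) Qx)
    (any? (Q? ∘ enum))

  isUnit? : ∀ p → Dec (IsUnit A p)
  isUnit? p = ∃? (λ r≈s pr≈1 → trans (*-cong refl (sym r≈s)) pr≈1) (λ r → (p * r) ≟ 1#)

  ∈⟨⟩? : ∀ gs x → Dec (x ∈⟨ gs ⟩)
  ∈⟨⟩? []       x = x ≟ 0#
  ∈⟨⟩? (g ∷ gs) x = ∃? (λ r≈s → ∈⟨⟩-resp gs (+-cong refl (-‿cong (*-cong r≈s refl))))
                       (λ r → ∈⟨⟩? gs (x - r * g))

  grow : List Carrier → List (Fin size) → List Carrier
  grow gs []       = gs
  grow gs (i ∷ is) with ∈⟨⟩? (enum i ∷ gs) 1#
  ... | yes _ = grow gs is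
  ... | no  _ = grow (enum i ∷ gs) is

  grow-⊇ : ∀ gs is → ⟨ gs ⟩ ⊆ ⟨ grow gs is ⟩
  grow-⊇ gs []       x x∈ = x∈
  grow-⊇ gs (i ∷ is) x x∈ with ∈⟨⟩? (enum i ∷ gs) 1#
  ... | yes _ = grow-⊇ gs is x x∈
  ... | no  _ = grow-⊇ (enum i ∷ gs) is x (∈⟨∷⟩ʳ (enum i) gs x∈)

  grow-proper : ∀ gs is → ¬ 1# ∈⟨ gs ⟩ → ¬ 1# ∈⟨ grow gs is ⟩
  grow-proper gs []       1∉ = 1∉
  grow-proper gs (i ∷ is) 1∉ with ∈⟨⟩? (enum i ∷ gs) 1#
  ... | yes _   = grow-proper gs is 1∉
  ... | no  1∉′ = grow-proper (enum i ∷ gs) is 1∉′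

  grow-absorbs : (J : Ideal A) → ¬ P J 1# → ∀ gs is → ⟨ grow gs is ⟩ ⊆ J →
    ∀ {j} → j ∈ is → P J (enum j) → enum j ∈⟨ grow gs is ⟩
  grow-absorbs J 1∉J gs (i ∷ is) grown⊆J j∈ j∈J with ∈⟨⟩? (enum i ∷ gs) 1# | j∈
  ... | yes 1∈ | here ≡.refl =
    ⊥-elim (1∉J (⟨∷⟩⊆ J {gs = gs} j∈J (λ x x∈ → grown⊆J x (grow-⊇ gs is x x∈)) 1# 1∈))
  ... | no _   | here ≡.refl = grow-⊇ (enum i ∷ gs) is _ (∈⟨∷⟩ˡ (enum i) gs)
  ... | yes _  | there j∈is  = grow-absorbs J 1∉J gs is grown⊆J j∈is j∈J
  ... | no _   | there j∈is  = grow-absorbs J 1∉J (enum i ∷ gs) is grown⊆J j∈is j∈J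

  proper⇒⊆maximal : ∀ gs → ¬ 1# ∈⟨ gs ⟩ → Σ[ N ∈ Ideal A ] IsMaximal A N × ⟨ gs ⟩ ⊆ N
  proper⇒⊆maximal gs 1∉ = ⟨ N ⟩ , (grow-proper gs (allFin size) 1∉ , maximal) , grow-⊇ gs (allFin size)
    where
    N : List Carrier
    N = grow gs (allFin size)
    maximal : ∀ J → ⟨ N ⟩ ⊆ J → ¬ P J 1# → J ⊆ ⟨ N ⟩
    maximal J N⊆J 1∉J y y∈J = ∈⟨⟩-resp N (proj₂ (surj y))
      (grow-absorbs J 1∉J gs (allFin size) N⊆J (∈-allFin _) (resp J (sym (proj₂ (surj y))) y∈J))

  nonunit∈maximal : (loc : IsLocal A) → ∀ {x} → ¬ IsUnit A x → P (proj₁ loc) x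
  nonunit∈maximal (M , _ , unique) {x} x∉U with proper⇒⊆maximal (x ∷ []) (x∉U ∘ 1∈⟨x⟩⇒unit)
  ... | N , N-maximal , ⟨x⟩⊆N = proj₁ (unique N N-maximal) x (⟨x⟩⊆N x (∈⟨∷⟩ˡ x []))

  #roots : (Carrier → Carrier) → Carrier → ℕ
  #roots f b = length (filter (λ i → f (enum i) ≟ b) (allFin size))

  #roots-cong : ∀ {f g} → (∀ x → f x ≈ g x) → ∀ b → #roots f b ≡ #roots g b
  #roots-cong f≈g b = ≡.cong length (filter-≐ _ _
    ((λ fx≈b → trans (sym (f≈g _)) fx≈b) , (λ gx≈b → trans (f≈g _) gx≈b)) (allFin size))

  #roots-unit-slope : ∀ {p} → IsUnit A p → ∀ q b → #roots (λ x → x * p - q) b ≡ 1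
  #roots-unit-slope {p} (p⁻¹ , pp⁻¹≈1) q b =
    length-filter-tabulate-unique (λ i → (enum i * p - q) ≟ b) (λ i → i) i₀ c-root unique
    where
    open ≈-Reasoning
    cancel : ∀ y → y * (p * p⁻¹) ≈ y
    cancel y = trans (*-cong refl pp⁻¹≈1) (*-identityʳ y)
    c : Carrier
    c = (b + q) * p⁻¹
    i₀ : Fin size
    i₀ = proj₁ (surj c)
    c-root : enum i₀ * p - q ≈ b
    c-root = begin
      enum i₀ * p - q               ≈⟨ +-cong (*-cong (proj₂ (surj c)) refl) refl ⟩
      (b + q) * p⁻¹ * p - q         ≈⟨ +-cong (trans (xy∙z≈x∙zy (b + q) p⁻¹ p) (cancel (b + q))) refl ⟩
      (b + q) - q                   ≈⟨ //-rightDividesʳ q b ⟩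
      b                             ∎
    unique : ∀ j → enum j * p - q ≈ b → j ≡ i₀
    unique j root = inj j i₀ (begin
      enum j                        ≈⟨ cancel (enum j) ⟨
      enum j * (p * p⁻¹)            ≈⟨ *-assoc (enum j) p p⁻¹ ⟨
      enum j * p * p⁻¹              ≈⟨ *-cong (//-rightDividesˡ q (enum j * p)) refl ⟨
      (enum j * p - q + q) * p⁻¹    ≈⟨ *-cong (+-cong root refl) refl ⟩
      c                             ≈⟨ proj₂ (surj c) ⟨
      enum i₀                       ∎)

  #roots-nonunit-slope : (I : Ideal A) → ∀ {p q b} → P I p → ¬ P I q → P I b →
    #roots (λ x → x * p - q) b ≡ 0
  #roots-nonunit-slope I {p} {q} {b} p∈I q∉I b∈I =
    length-filter-tabulate-none (λ i → (enum i * p - q) ≟ b) (λ i → i) λ i root →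
      q∉I (resp I (x-[x-y]≈y _ q) (-‿closed I (*-cl I (enum i) p∈I) (resp I (sym root) b∈I)))

  #roots-affine-local : (loc : IsLocal A) → ∀ {p q b} → ¬ (P (proj₁ loc) p × P (proj₁ loc) q) →
    P (proj₁ loc) b → #roots (λ x → x * p - q) b ≡ #roots (λ x → x * p - q) 0#
  #roots-affine-local loc {p} {q} {b} comaximal b∈M with isUnit? p
  ... | yes p∈U = ≡.trans (#roots-unit-slope p∈U q b) (≡.sym (#roots-unit-slope p∈U q 0#))
  ... | no  p∉U = ≡.trans (#roots-nonunit-slope M p∈M q∉M b∈M)
                          (≡.sym (#roots-nonunit-slope M p∈M q∉M (zero∈ M)))
    where
    M : Ideal A
    M = proj₁ loc
    p∈M : P M p
    p∈M = nonunit∈maximal loc p∉U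
    q∉M : ¬ P M q
    q∉M q∈M = comaximal (p∈M , q∈M)

  #roots-continuant : (loc : IsLocal A) → ∀ {b} → P (proj₁ loc) b → ∀ xs →
    #roots (λ x → Krev A (x ∷ xs)) b ≡ #roots (λ x → Krev A (x ∷ xs)) 0#
  #roots-continuant loc@(M , (1∉M , _) , _) {b} b∈M xs = begin
    #roots (λ x → Krev A (x ∷ xs)) b
      ≡⟨ #roots-cong (λ x → Krev-∷ x xs) b ⟩
    #roots (λ x → x * Krev A xs - Kprev xs) b
      ≡⟨ #roots-affine-local loc (continuants-comaximal M 1∉M xs) b∈M ⟩
    #roots (λ x → x * Krev A xs - Kprev xs) 0#
      ≡⟨ #roots-cong (λ x → Krev-∷ x xs) 0# ⟨
    #roots (λ x → Krev A (x ∷ xs)) 0#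
      ∎
    where open ≡-Reasoning

  reversedEntries : ∀ {n} → Vec (Fin size) n → List Carrier
  reversedEntries v = reverse (toList (Vec.map enum v))

  countR-∷ʳ : ∀ n b → countR A _≟_ F (suc n) b ≡
    sum (map (λ v → #roots (λ x → Krev A (x ∷ reversedEntries v)) b) (allVecs size n))
  countR-∷ʳ n b = begin
    length (filter K≟b (allVecs size (suc n)))
      ≡⟨ ≡.cong (length ∘ filter K≟b) (allVecs-∷ʳ size n) ⟩
    length (filter K≟b (concatMap (λ v → map (v ∷ʳ_) (allFin size)) (allVecs size n)))
      ≡⟨ length-filter-concatMap K≟b _ (allVecs size n) ⟩
    sum (map (λ v → length (filter K≟b (map (v ∷ʳ_) (allFin size)))) (allVecs size n))
      ≡⟨ ≡.cong sum (map-cong (λ v → length-filter-map K≟b (v ∷ʳ_) (allFin size)) (allVecs size n)) ⟩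
    sum (map (λ v → length (filter (K≟b ∘ (v ∷ʳ_)) (allFin size))) (allVecs size n))
      ≡⟨ ≡.cong sum (map-cong (λ v → ≡.cong length (filter-≐ _ _ (K-∷ʳ-≐ v) (allFin size)))
                              (allVecs size n)) ⟩
    sum (map (λ v → #roots (λ x → Krev A (x ∷ reversedEntries v)) b) (allVecs size n)) ∎
    where
    open ≡-Reasoning
    K≟b : U.Decidable (λ v → K A (suc n) (Vec.map enum v) ≈ b)
    K≟b v = K A (suc n) (Vec.map enum v) ≟ b
    K-∷ʳ : ∀ v j → K A (suc n) (Vec.map enum (v ∷ʳ j)) ≡ Krev A (enum j ∷ reversedEntries v)
    K-∷ʳ v j = ≡.cong (Krev A) (≡.trans (≡.cong (reverse ∘ toList) (map-∷ʳ enum j v))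
                                        (reverse-toList-∷ʳ (Vec.map enum v) (enum j)))
    K-∷ʳ-≐ : ∀ v → (λ j → K A (suc n) (Vec.map enum (v ∷ʳ j)) ≈ b)
                 ≐ (λ j → Krev A (enum j ∷ reversedEntries v) ≈ b)
    K-∷ʳ-≐ v = (λ {j} → ≡.subst (_≈ b) (K-∷ʳ v j)) , (λ {j} → ≡.subst (_≈ b) (≡.sym (K-∷ʳ v j)))

-- The argument only needs n ≥ 1.
proposition3p5 : (A : CommutativeRing 0ℓ 0ℓ)
    → (_≟_ : Decidable (CommutativeRing._≈_ A))
    → (F : FiniteEnum A)
    → IsLocal A
    → (a : CommutativeRing.Carrier A)
    → ¬ IsUnit A a
    → (n : ℕ) → n ≥ 2
    → countR A _≟_ F n a ≡ countR A _≟_ F n (CommutativeRing.0# A)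
proposition3p5 A _≟_ F loc a a∉U (suc n) _ = begin
  countR A _≟_ F (suc n) a                             ≡⟨ countR-∷ʳ n a ⟩
  sum (map (λ v → #roots (K-last v) a) (allVecs size n))
    ≡⟨ ≡.cong sum (map-cong (λ v → #roots-continuant loc a∈M (reversedEntries v)) (allVecs size n)) ⟩
  sum (map (λ v → #roots (K-last v) 0#) (allVecs size n)) ≡⟨ countR-∷ʳ n 0# ⟨
  countR A _≟_ F (suc n) 0#                            ∎
  where
  open CommutativeRing A using (Carrier; 0#)
  open FiniteEnum F using (size)
  open FiniteRing A _≟_ F
  open ≡-Reasoning
  a∈M : P (proj₁ loc) a
  a∈M = nonunit∈maximal loc a∉U
  K-last : Vec (Fin size) n → Carrier → Carrier
  K-last v x = Krev A (x ∷ reversedEntries v)
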